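{- There is no irreducible subcube partition of $\{0,1\}^4$ of size $10$.
   Context: A subcube partition of length $n$ is a partition of $\{0,1\}^n$ into subcubes (sets obtained by fixing some coordinates to given bits); its size is the number of subcubes. It is irreducible if there is no subset $G$ with $1<|G|<|F|$ whose union is a subcube. -}

module Defs where

open import Data.Nat using (ℕ; _<_)
open import Data.Bool using (Bool)
open import Data.Maybe using (Maybe; just; nothing)
open import Data.Fin using (Fin)
open import Data.Fin.Subset using (Subset; _∈_; ∣_∣)
open import Data.Vec using (Vec; []; _∷_; lookup)
open import Data.Unit using (⊤)
open import Data.Product using (Σ; _×_; ∃)
open import Relation.Binary.PropositionalEquality using (_≡_)
open import Relation.Nullary using (¬_)
open import Function.Bundles using (_⇔_)

-- A subcube of {0,1}^n: each coordinate is fixed to a bit (just b) or free (nothing).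
Subcube : ℕ → Set
Subcube n = Vec (Maybe Bool) n

Point : ℕ → Set
Point n = Vec Bool n

_≼_ : Bool → Maybe Bool → Set
b ≼ nothing = ⊤
b ≼ just c  = b ≡ c

_∈ᶜ_ : ∀ {n} → Point n → Subcube n → Set
[]       ∈ᶜ []       = ⊤
(b ∷ xs) ∈ᶜ (c ∷ cs) = (b ≼ c) × (xs ∈ᶜ cs)

IsPartition : ∀ {n m} → Vec (Subcube n) m → Set
IsPartition {n} {m} F =
  ∀ (x : Point n) →
    (∃ λ (i : Fin m) → x ∈ᶜ lookup F i) ×
    (∀ (i j : Fin m) → x ∈ᶜ lookup F i → x ∈ᶜ lookup F j → i ≡ j)

UnionIsSubcube : ∀ {n m} → Vec (Subcube n) m → Subset m → Set
UnionIsSubcube {n} {m} F G =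
  Σ (Subcube n) λ c → ∀ (x : Point n) →
    (x ∈ᶜ c) ⇔ (∃ λ (i : Fin m) → (i ∈ G) × (x ∈ᶜ lookup F i))

Irreducible : ∀ {n m} → Vec (Subcube n) m → Set
Irreducible {n} {m} F =
  ¬ (Σ (Subset m) λ G → (1 < ∣ G ∣) × (∣ G ∣ < m) × UnionIsSubcube F G)

-- Suppose F is an irreducible partition of {0,1}^4 into 10 subcubes, and rebuild
-- it piece by piece: the next piece is a subcube through the first point not yet
-- covered that avoids the pieces placed so far. Already a partial list of pieces
-- contradicts irreducibility as soon as some subcube c is covered by the placed
-- pieces lying inside c, at least two of them, while some placed piece does not
-- lie inside c: the pieces of F inside c then form a subfamily with at least two
-- and fewer than 10 members whose union is c. Testing the hulls of the newest
-- piece with the earlier ones, and every subcube once the cover is complete, kills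
-- every branch of this search, which the type checker runs.
module Submission where

open import Defs
open import Data.Bool using (Bool; true; false; T; not; _∧_; _∨_; if_then_else_)
open import Data.Bool.ListAction using (any)
open import Data.Bool.Properties using (T-∧; T-∨; T-≡)
open import Data.Empty using (⊥-elim)
open import Data.Fin using (Fin; zero; suc; _≟_)
open import Data.Fin.Subset using (Subset; _∈_; _∉_; ∣_∣; ⊤; ⊥; inside; outside)
open import Data.Fin.Subset.Properties using (∈⊤; ∉⊥; ∣⊤∣≡n; ∣⊥∣≡0; ∣p∣≤n; ∣p∣≡n⇒p≡⊤; ∣⁅x⁆∣≡1; x∈⁅y⁆⇒x≡y; p⊂q⇒∣p∣<∣q∣; p⊆q⇒∣p∣≤∣q∣)
open import Data.List using (List; []; _∷_; [_]; map; concatMap; length)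
open import Data.List.Membership.Propositional using (find; lose) renaming (_∈_ to _∈ˡ_)
open import Data.List.Relation.Unary.Any using (here; there)
open import Data.List.Relation.Unary.Any.Properties using (any⁺; any⁻)
open import Data.Maybe using (Maybe; just; nothing; fromMaybe; _<∣>_)
import Data.Maybe as Maybe
open import Data.Nat using (ℕ; zero; suc; _<_; _≤_; _<ᵇ_; _≤ᵇ_)
open import Data.Nat.Properties using (<ᵇ⇒<; ≤ᵇ⇒≤; <⇒≱; ≤-antisym)
open import Data.Product using (∃; _×_; _,_; proj₁; proj₂)
open import Data.Sum using (_⊎_; inj₁; inj₂)
open import Data.Unit using (tt)
open import Data.Vec using (Vec; []; _∷_; lookup; tabulate; zipWith; _[_]≔_; here; there)
open import Data.Vec.Properties using ([]=⇒lookup; lookup⇒[]=; lookup∘tabulate; []≔-updates; []≔-minimal; lookup∘update′)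
open import Function using (_∘_)
open import Function.Bundles using (_⇔_; Equivalence; mk⇔)
open import Relation.Binary.PropositionalEquality using (_≡_; _≢_; refl; sym; trans; cong; subst)
open import Relation.Nullary using (¬_; yes; no)

open Equivalence using (to; from)

T-not⇒¬T : ∀ {b} → T (not b) → ¬ T b
T-not⇒¬T {false} _ ()

¬T-not⇒T : ∀ {b} → ¬ T (not b) → T b
¬T-not⇒T {false} h = h tt
¬T-not⇒T {true}  _ = tt

x∉p⇒∣p∣<n : ∀ {n x} {p : Subset n} → x ∉ p → ∣ p ∣ < n
x∉p⇒∣p∣<n {n} {x} {p} x∉p = subst (∣ p ∣ <_) (∣⊤∣≡n n) (p⊂q⇒∣p∣<∣q∣ ((λ _ → ∈⊤) , x , ∈⊤ , x∉p))

x∈p∧y∈p∧x≢y⇒1<∣p∣ : ∀ {n x y} {p : Subset n} → x ∈ p → y ∈ p → x ≢ y → 1 < ∣ p ∣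
x∈p∧y∈p∧x≢y⇒1<∣p∣ {x = x} {y} {p} x∈p y∈p x≢y = subst (_< ∣ p ∣) (∣⁅x⁆∣≡1 x)
  (p⊂q⇒∣p∣<∣q∣ ((λ z∈⁅x⁆ → subst (_∈ p) (sym (x∈⁅y⁆⇒x≡y x z∈⁅x⁆)) x∈p) ,
                 y , y∈p , λ y∈⁅x⁆ → x≢y (sym (x∈⁅y⁆⇒x≡y x y∈⁅x⁆))))

∀x∈p⇒n≤∣p∣ : ∀ {n} {p : Subset n} → (∀ x → x ∈ p) → n ≤ ∣ p ∣
∀x∈p⇒n≤∣p∣ {n} {p} all∈p = subst (_≤ ∣ p ∣) (∣⊤∣≡n n) (p⊆q⇒∣p∣≤∣q∣ {p = ⊤} (λ {x} _ → all∈p x))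

n≤∣p∣⇒x∈p : ∀ {n x} {p : Subset n} → n ≤ ∣ p ∣ → x ∈ p
n≤∣p∣⇒x∈p {p = p} n≤∣p∣ = subst (_ ∈_) (sym (∣p∣≡n⇒p≡⊤ (≤-antisym (∣p∣≤n p) n≤∣p∣))) ∈⊤

∈-tabulate⁺ : ∀ {n} {f : Fin n → Bool} {i} → T (f i) → i ∈ tabulate f
∈-tabulate⁺ {f = f} {i} fi = lookup⇒[]= i _ (trans (lookup∘tabulate f i) (to T-≡ fi))

∈-tabulate⁻ : ∀ {n} {f : Fin n → Bool} {i} → i ∈ tabulate f → T (f i)
∈-tabulate⁻ {f = f} {i} i∈ = from T-≡ (trans (sym (lookup∘tabulate f i)) ([]=⇒lookup i∈))

x∈p[x]≔inside : ∀ {n} (x : Fin n) (p : Subset n) → x ∈ p [ x ]≔ inside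
x∈p[x]≔inside x p = []≔-updates p x

∈-[]≔inside⁺ : ∀ {n} {x y : Fin n} {p : Subset n} → y ∈ p → y ∈ p [ x ]≔ inside
∈-[]≔inside⁺ {x = x} {y} {p} y∈p with y ≟ x
... | yes refl = x∈p[x]≔inside x p
... | no y≢x = []≔-minimal p y x y≢x y∈p

∈-[]≔inside⁻ : ∀ {n} {x y : Fin n} {p : Subset n} → y ∈ p [ x ]≔ inside → y ≡ x ⊎ y ∈ p
∈-[]≔inside⁻ {x = x} {y} {p} y∈ with y ≟ x
... | yes y≡x = inj₁ y≡x
... | no y≢x = inj₂ (lookup⇒[]= y p (trans (sym (lookup∘update′ y≢x p inside)) ([]=⇒lookup y∈)))

∣p[x]≔inside∣ : ∀ {n} {x : Fin n} {p : Subset n} → x ∉ p → ∣ p [ x ]≔ inside ∣ ≡ suc ∣ p ∣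
∣p[x]≔inside∣ {x = zero}  {inside  ∷ p} x∉p = ⊥-elim (x∉p here)
∣p[x]≔inside∣ {x = zero}  {outside ∷ p} x∉p = refl
∣p[x]≔inside∣ {x = suc x} {inside  ∷ p} x∉p = cong suc (∣p[x]≔inside∣ (x∉p ∘ there))
∣p[x]≔inside∣ {x = suc x} {outside ∷ p} x∉p = ∣p[x]≔inside∣ (x∉p ∘ there)

_==_ : Bool → Bool → Bool
true  == b = b
false == b = not b

==⇒≡ : ∀ {a b} → T (a == b) → a ≡ b
==⇒≡ {true}  {true}  _ = refl
==⇒≡ {false} {false} _ = refl

==-refl : ∀ a → T (a == a)
==-refl true  = tt
==-refl false = tt

_∈ᵇ_ : ∀ {n} → Point n → Subcube n → Bool
[]      ∈ᵇ []             = true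
(b ∷ x) ∈ᵇ (nothing ∷ cs) = x ∈ᵇ cs
(b ∷ x) ∈ᵇ (just c ∷ cs)  = (b == c) ∧ x ∈ᵇ cs

∈ᵇ⇔∈ᶜ : ∀ {n} {x : Point n} {c} → T (x ∈ᵇ c) ⇔ x ∈ᶜ c
∈ᵇ⇔∈ᶜ {x = []}    {[]}           = mk⇔ _ _
∈ᵇ⇔∈ᶜ {x = b ∷ x} {nothing ∷ cs} = mk⇔ (λ h → tt , to ∈ᵇ⇔∈ᶜ h) (from ∈ᵇ⇔∈ᶜ ∘ proj₂)
∈ᵇ⇔∈ᶜ {x = b ∷ x} {just c ∷ cs}  = mk⇔
  (λ h → let b≡c , x∈cs = to T-∧ h in ==⇒≡ b≡c , to ∈ᵇ⇔∈ᶜ x∈cs)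
  (λ { (refl , x∈cs) → from T-∧ (==-refl b , from ∈ᵇ⇔∈ᶜ x∈cs) })

_⊆ᵇ_ : ∀ {n} → Subcube n → Subcube n → Bool
[]             ⊆ᵇ []            = true
(a ∷ as)       ⊆ᵇ (nothing ∷ cs) = as ⊆ᵇ cs
(just a ∷ as)  ⊆ᵇ (just c ∷ cs)  = (a == c) ∧ as ⊆ᵇ cs
(nothing ∷ as) ⊆ᵇ (just c ∷ cs)  = false

⊆ᵇ-sound : ∀ {n} {a c : Subcube n} → T (a ⊆ᵇ c) → ∀ {x} → x ∈ᶜ a → x ∈ᶜ c
⊆ᵇ-sound {a = []}         {[]}          _ {[]}    _             = tt
⊆ᵇ-sound {a = _ ∷ _}      {nothing ∷ _} h {_ ∷ _} (_ , x∈as)    = tt , ⊆ᵇ-sound h x∈as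
⊆ᵇ-sound {a = just a ∷ _} {just c ∷ _}  h {_ ∷ _} (refl , x∈as) =
  let a≡c , as⊆cs = to T-∧ h in ==⇒≡ a≡c , ⊆ᵇ-sound as⊆cs x∈as

⊆ᵇ-refl : ∀ {n} (a : Subcube n) → T (a ⊆ᵇ a)
⊆ᵇ-refl []             = tt
⊆ᵇ-refl (nothing ∷ as) = ⊆ᵇ-refl as
⊆ᵇ-refl (just a ∷ as)  = from T-∧ (==-refl a , ⊆ᵇ-refl as)

meetPoint : ∀ {n} → Subcube n → Subcube n → Point n
meetPoint = zipWith (λ a b → fromMaybe (fromMaybe false b) a)

meetPoint-∈ˡ : ∀ {n} (a b : Subcube n) → meetPoint a b ∈ᶜ a
meetPoint-∈ˡ []             []       = tt
meetPoint-∈ˡ (just a ∷ as)  (_ ∷ bs) = refl , meetPoint-∈ˡ as bs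
meetPoint-∈ˡ (nothing ∷ as) (_ ∷ bs) = tt , meetPoint-∈ˡ as bs

overlaps : ∀ {n} → Subcube n → Subcube n → Bool
overlaps []            []            = true
overlaps (just a ∷ as) (just b ∷ bs) = (a == b) ∧ overlaps as bs
overlaps (_ ∷ as)      (_ ∷ bs)      = overlaps as bs

overlaps⇒meetPoint-∈ʳ : ∀ {n} {a b : Subcube n} → T (overlaps a b) → meetPoint a b ∈ᶜ b
overlaps⇒meetPoint-∈ʳ {a = []}          {[]}          _ = tt
overlaps⇒meetPoint-∈ʳ {a = just a ∷ _}  {just b ∷ _}  h =
  let a≡b , rest = to T-∧ h in ==⇒≡ a≡b , overlaps⇒meetPoint-∈ʳ rest
overlaps⇒meetPoint-∈ʳ {a = just a ∷ _}  {nothing ∷ _} h = tt , overlaps⇒meetPoint-∈ʳ h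
overlaps⇒meetPoint-∈ʳ {a = nothing ∷ _} {just b ∷ _}  h = refl , overlaps⇒meetPoint-∈ʳ h
overlaps⇒meetPoint-∈ʳ {a = nothing ∷ _} {nothing ∷ _} h = tt , overlaps⇒meetPoint-∈ʳ h

overlaps-sound : ∀ {n} {a b : Subcube n} → T (overlaps a b) → ∃ λ x → x ∈ᶜ a × x ∈ᶜ b
overlaps-sound {a = a} {b} h = meetPoint a b , meetPoint-∈ˡ a b , overlaps⇒meetPoint-∈ʳ h

_⊔ₘ_ : Maybe Bool → Maybe Bool → Maybe Bool
just a ⊔ₘ just b = if a == b then just a else nothing
_      ⊔ₘ _      = nothing

-- The smallest subcube containing a and b. It only proposes candidates to
-- reducer, which checks them, so none of its properties are needed.
hull : ∀ {n} → Subcube n → Subcube n → Subcube n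
hull = zipWith _⊔ₘ_

allPoints : ∀ {n} → (Point n → Bool) → Bool
allPoints {zero}  f = f []
allPoints {suc n} f = allPoints (f ∘ (false ∷_)) ∧ allPoints (f ∘ (true ∷_))

allPoints-sound : ∀ {n} {f : Point n → Bool} → T (allPoints f) → ∀ x → T (f x)
allPoints-sound {zero}  h []          = h
allPoints-sound {suc n} h (false ∷ x) = allPoints-sound (proj₁ (to T-∧ h)) x
allPoints-sound {suc n} h (true  ∷ x) = allPoints-sound (proj₂ (to T-∧ h)) x

firstPoint : ∀ {n} → (Point n → Bool) → Maybe (Point n)
firstPoint {zero}  f = if f [] then just [] else nothing
firstPoint {suc n} f = Maybe.map (false ∷_) (firstPoint (f ∘ (false ∷_)))
                   <∣> Maybe.map (true ∷_) (firstPoint (f ∘ (true ∷_)))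

data FirstPoint {n} (f : Point n → Bool) : Maybe (Point n) → Set where
  found : ∀ {x} → T (f x) → FirstPoint f (just x)
  none  : (∀ x → ¬ T (f x)) → FirstPoint f nothing

firstPoint-spec : ∀ {n} (f : Point n → Bool) → FirstPoint f (firstPoint f)
firstPoint-spec {zero} f with f [] in e
... | true  = found (from T-≡ e)
... | false = none λ { [] → subst T e }
firstPoint-spec {suc n} f
  with firstPoint (f ∘ (false ∷_)) | firstPoint-spec (f ∘ (false ∷_))
... | just _  | found p = found p
... | nothing | none ¬p₀
  with firstPoint (f ∘ (true ∷_)) | firstPoint-spec (f ∘ (true ∷_))
...   | just _  | found p   = found p
...   | nothing | none ¬p₁ = none λ { (false ∷ x) → ¬p₀ x ; (true ∷ x) → ¬p₁ x }

cubes : ∀ n → List (Subcube n)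
cubes zero    = [ [] ]
cubes (suc n) = concatMap (λ a → map (a ∷_) (cubes n)) (nothing ∷ just false ∷ just true ∷ [])

allCubesThrough : ∀ {n} → Point n → (Subcube n → Bool) → Bool
allCubesThrough []      f = f []
allCubesThrough (b ∷ x) f = allCubesThrough x (f ∘ (just b ∷_)) ∧ allCubesThrough x (f ∘ (nothing ∷_))

allCubesThrough-sound : ∀ {n} {x : Point n} {f c} → T (allCubesThrough x f) → x ∈ᶜ c → T (f c)
allCubesThrough-sound {x = []}    {c = []}          h _          = h
allCubesThrough-sound {x = b ∷ x} {c = just .b ∷ c} h (refl , m) = allCubesThrough-sound (proj₁ (to T-∧ h)) m
allCubesThrough-sound {x = b ∷ x} {c = nothing ∷ c} h (_ , m)    = allCubesThrough-sound (proj₂ (to T-∧ h)) m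

module Search (n m : ℕ) where

  covers : List (Subcube n) → Point n → Bool
  covers pl x = any (x ∈ᵇ_) pl

  uncovered : List (Subcube n) → Point n → Bool
  uncovered pl = not ∘ covers pl

  escapes : List (Subcube n) → Subcube n → Bool
  escapes pl c = any (λ d → not (d ⊆ᵇ c)) pl

  twoInside : List (Subcube n) → Subcube n → Bool
  twoInside pl c = any (λ a → a ⊆ᵇ c ∧ any (λ b → b ⊆ᵇ c ∧ not (b ⊆ᵇ a)) pl) pl

  filledInside : List (Subcube n) → Subcube n → Bool
  filledInside pl c = allPoints (λ y → not (y ∈ᵇ c) ∨ any (λ a → a ⊆ᵇ c ∧ y ∈ᵇ a) pl)

  reducer : List (Subcube n) → Subcube n → Bool
  reducer pl c = escapes pl c ∧ twoInside pl c ∧ filledInside pl c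

  hullReducer : List (Subcube n) → Bool
  hullReducer []           = false
  hullReducer (new ∷ rest) = any (λ a → reducer (new ∷ rest) (hull new a)) rest

  -- The fuel k only needs to exceed m: each level places a piece, and m placed
  -- pieces are never extended.
  mutual
    excluded : ℕ → List (Subcube n) → Bool
    excluded zero    pl = false
    excluded (suc k) pl = hullReducer pl ∨ excludedAt k pl (firstPoint (uncovered pl))

    excludedAt : ℕ → List (Subcube n) → Maybe (Point n) → Bool
    excludedAt k pl nothing  = (length pl <ᵇ m) ∨ any (reducer pl) (cubes n)
    excludedAt k pl (just x) = (m ≤ᵇ length pl)
      ∨ allCubesThrough x (λ c → any (overlaps c) pl ∨ excluded k (c ∷ pl))

module Soundness {n m} (F : Vec (Subcube n) m) (partition : IsPartition F)
                 (irreducible : Irreducible F) where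

  open Search n m

  piece : Fin m → Subcube n
  piece = lookup F

  unique : ∀ {x i j} → x ∈ᶜ piece i → x ∈ᶜ piece j → i ≡ j
  unique {x} = proj₂ (partition x) _ _

  -- pl lists the pieces of F indexed by S, each once (that is what length≡ adds).
  record Realises (pl : List (Subcube n)) (S : Subset m) : Set where
    field
      length≡ : length pl ≡ ∣ S ∣
      pieceOf : ∀ {a} → a ∈ˡ pl → ∃ λ i → i ∈ S × piece i ≡ a
      listed  : ∀ {i} → i ∈ S → piece i ∈ˡ pl
  open Realises

  realises-[] : Realises [] ⊥
  realises-[] = record
    { length≡ = sym (∣⊥∣≡0 m) ; pieceOf = λ () ; listed = ⊥-elim ∘ ∉⊥ }

  realises-∷ : ∀ {pl S i} → Realises pl S → i ∉ S → Realises (piece i ∷ pl) (S [ i ]≔ inside)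
  realises-∷ {pl} {S} {i} r i∉S = record
    { length≡ = trans (cong suc (length≡ r)) (sym (∣p[x]≔inside∣ i∉S))
    ; pieceOf = λ { (here refl) → i , x∈p[x]≔inside i S , refl
                  ; (there a∈pl) → let j , j∈S , e = pieceOf r a∈pl in j , ∈-[]≔inside⁺ j∈S , e }
    ; listed  = λ j∈ → listed′ (∈-[]≔inside⁻ j∈) }
    where
    listed′ : ∀ {j} → j ≡ i ⊎ j ∈ S → piece j ∈ˡ piece i ∷ pl
    listed′ (inj₁ refl) = here refl
    listed′ (inj₂ j∈S)  = there (listed r j∈S)

  any-piece : ∀ {pl S} (p : Subcube n → Bool) → Realises pl S → T (any p pl) →
              ∃ λ i → i ∈ S × T (p (piece i))
  any-piece {pl} p r h with find (any⁻ p pl h)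
  ... | a , a∈pl , pa with pieceOf r a∈pl
  ... | i , i∈S , refl = i , i∈S , pa

  reducer-absurd : ∀ {pl S c} → Realises pl S → ¬ T (reducer pl c)
  reducer-absurd {pl} {S} {c} r h = irreducible (G , 1<∣G∣ , ∣G∣<m , c , λ y → mk⇔ (c⊆⋃G y) (⋃G⊆c y))
    where
    G : Subset m
    G = tabulate (λ i → piece i ⊆ᵇ c)

    escapes-c : T (escapes pl c)
    escapes-c = proj₁ (to T-∧ h)
    twoInside-c : T (twoInside pl c)
    twoInside-c = proj₁ (to (T-∧ {twoInside pl c}) (proj₂ (to (T-∧ {escapes pl c}) h)))
    filled-c : T (filledInside pl c)
    filled-c = proj₂ (to (T-∧ {twoInside pl c}) (proj₂ (to (T-∧ {escapes pl c}) h)))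

    ∣G∣<m : ∣ G ∣ < m
    ∣G∣<m with any-piece (λ d → not (d ⊆ᵇ c)) r escapes-c
    ... | i , _ , i⊈c = x∉p⇒∣p∣<n (T-not⇒¬T i⊈c ∘ ∈-tabulate⁻)

    1<∣G∣ : 1 < ∣ G ∣
    1<∣G∣ with any-piece (λ a → a ⊆ᵇ c ∧ any (λ b → b ⊆ᵇ c ∧ not (b ⊆ᵇ a)) pl) r twoInside-c
    ... | i , _ , hi with to T-∧ hi
    ... | i⊆c , hj with any-piece (λ b → b ⊆ᵇ c ∧ not (b ⊆ᵇ piece i)) r hj
    ... | j , _ , hij with to T-∧ hij
    ... | j⊆c , j⊈i = x∈p∧y∈p∧x≢y⇒1<∣p∣ {p = G} (∈-tabulate⁺ i⊆c) (∈-tabulate⁺ j⊆c)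
                        λ { refl → T-not⇒¬T j⊈i (⊆ᵇ-refl (piece i)) }

    c⊆⋃G : ∀ y → y ∈ᶜ c → ∃ λ i → i ∈ G × y ∈ᶜ piece i
    c⊆⋃G y y∈c with to T-∨ (allPoints-sound filled-c y)
    ... | inj₁ y∉c = ⊥-elim (T-not⇒¬T y∉c (from ∈ᵇ⇔∈ᶜ y∈c))
    ... | inj₂ hy with any-piece (λ a → a ⊆ᵇ c ∧ y ∈ᵇ a) r hy
    ... | i , _ , hi = i , ∈-tabulate⁺ (proj₁ (to T-∧ hi)) , to ∈ᵇ⇔∈ᶜ (proj₂ (to T-∧ hi))

    ⋃G⊆c : ∀ y → (∃ λ i → i ∈ G × y ∈ᶜ piece i) → y ∈ᶜ c
    ⋃G⊆c y (i , i∈G , y∈i) = ⊆ᵇ-sound (∈-tabulate⁻ i∈G) y∈i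

  hullReducer-absurd : ∀ {pl S} → Realises pl S → ¬ T (hullReducer pl)
  hullReducer-absurd {_ ∷ rest} r h with find (any⁻ _ rest h)
  ... | _ , _ , reduces = reducer-absurd r reduces

  covered-by-listed : ∀ {pl S x} → Realises pl S → T (covers pl x) → ∃ λ j → j ∈ S × x ∈ᶜ piece j
  covered-by-listed {x = x} r h with any-piece (x ∈ᵇ_) r h
  ... | j , j∈S , x∈j = j , j∈S , to ∈ᵇ⇔∈ᶜ x∈j

  uncovered-unlisted : ∀ {pl S x i} → Realises pl S → T (uncovered pl x) → x ∈ᶜ piece i → i ∉ S
  uncovered-unlisted {x = x} r x-uncovered x∈i i∈S =
    T-not⇒¬T x-uncovered (any⁺ (x ∈ᵇ_) (lose (listed r i∈S) (from ∈ᵇ⇔∈ᶜ x∈i)))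

  all-covered⇒all-listed : ∀ {pl S} → Realises pl S → (∀ x → ¬ T (uncovered pl x)) → ∀ i → i ∈ S
  all-covered⇒all-listed {pl} {S} r all-covered i
    with covered-by-listed r (¬T-not⇒T (all-covered (meetPoint (piece i) (piece i))))
  ... | j , j∈S , y∈j = subst (_∈ S) (unique y∈j (meetPoint-∈ˡ (piece i) (piece i))) j∈S

  unlisted-disjoint : ∀ {pl S i} → Realises pl S → i ∉ S → ¬ T (any (overlaps (piece i)) pl)
  unlisted-disjoint {S = S} {i} r i∉S h with any-piece (overlaps (piece i)) r h
  ... | j , j∈S , meets with overlaps-sound meets
  ...   | y , y∈i , y∈j = i∉S (subst (_∈ S) (unique y∈j y∈i) j∈S)

  complete-absurd : ∀ {pl S} → Realises pl S → (∀ x → ¬ T (uncovered pl x)) →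
                    ¬ T ((length pl <ᵇ m) ∨ any (reducer pl) (cubes n))
  complete-absurd {pl} r all-covered h with to T-∨ h
  ... | inj₁ short = <⇒≱ (<ᵇ⇒< _ _ short)
        (subst (m ≤_) (sym (length≡ r)) (∀x∈p⇒n≤∣p∣ (all-covered⇒all-listed r all-covered)))
  ... | inj₂ some-reducer with find (any⁻ (reducer pl) (cubes n) some-reducer)
  ...   | _ , _ , reduces = reducer-absurd r reduces

  excluded-sound : ∀ k {pl S} → Realises pl S → ¬ T (excluded k pl)
  excluded-sound (suc k) {pl} r h with to T-∨ h
  ... | inj₁ reduces = hullReducer-absurd r reduces
  ... | inj₂ h′ with firstPoint (uncovered pl) | firstPoint-spec (uncovered pl) | h′
  ...   | nothing | none all-covered | h″ = complete-absurd r all-covered h″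
  ...   | just x  | found x-unc      | h″ with proj₁ (partition x)
  ...     | i , x∈i with uncovered-unlisted r x-unc x∈i | to T-∨ h″
  ...       | i∉S | inj₁ m≤length = i∉S (n≤∣p∣⇒x∈p (subst (m ≤_) (length≡ r) (≤ᵇ⇒≤ _ _ m≤length)))
  ...       | i∉S | inj₂ branches with to T-∨ (allCubesThrough-sound branches x∈i)
  ...         | inj₁ meets = unlisted-disjoint r i∉S meets
  ...         | inj₂ rest  = excluded-sound k (realises-∷ r i∉S) rest

-- The hypothesis is an equation rather than T (...) because refl is checked by
-- the conversion checker, which runs the search several times faster than the
-- reduction needed to check tt against T (...).
no-irreducible-partition : ∀ n m k → Search.excluded n m k [] ≡ true →
                           (F : Vec (Subcube n) m) → ¬ (IsPartition F × Irreducible F)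
no-irreducible-partition n m k searched F (partition , irreducible) =
  excluded-sound k realises-[] (from T-≡ searched)
  where open Soundness F partition irreducible

lemma2p44 : (F : Vec (Subcube 4) 10) → ¬ (IsPartition F × Irreducible F)
lemma2p44 = no-irreducible-partition 4 10 11 refl
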